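{- The linear span of the unique $\mathcal{M}_{\mathsf{BNC}}$-clique of arity $1$ (the unit of $\mathrm{NC}\mathcal{M}_{\mathsf{BNC}}$) together with all noncrossing $\mathcal{M}_{\mathsf{BNC}}$-cliques having no edge and no base labeled by $\mathds{1}$ forms a suboperad of $\mathrm{NC}\mathcal{M}_{\mathsf{BNC}}$ isomorphic to the operad $\mathsf{BNC}$. Moreover, $\phi_{\mathsf{BNC}}$ is an isomorphism between these two operads.
   Context: Work over a field $\mathbb{K}$ of characteristic zero. For a unitary magma $\mathcal{M}$ (with product $\star$ and unit $\mathds{1}_\mathcal{M}$), an $\mathcal{M}$-clique of arity $n$ is a regular polygon with $n+1$ vertices, numbered $1,\dots,n+1$, all of whose arcs (the base $(1,n+1)$, the edges $(i,i+1)$, and the diagonals) are labeled by elements of $\mathcal{M}$; an arc labeled by $\mathds{1}_\mathcal{M}$ is regarded as absent, and the others are called solid. It is noncrossing if no two solid diagonals cross. $\mathrm{NC}\mathcal{M}$ is the operad on the linear span of noncrossing $\mathcal{M}$-cliques whose partial composition $\mathfrak{p}\circ_i\mathfrak{q}$ glues the base of $\mathfrak{q}$ onto the $i$th edge of $\mathfrak{p}$ and labels the resulting common arc by $\mathfrak{p}_i\star\mathfrak{q}_0$ (the $i$th edge label of $\mathfrak{p}$ times the base label of $\mathfrak{q}$); its unit is the unique clique of arity $1$. A bicolored noncrossing configuration is a noncrossing configuration (polygon with noncrossing arcs) where each present arc is either thick or dotted, dotted arcs being diagonals only. $\mathsf{BNC}(n)$, $n\ge 2$, is the linear span of these configurations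 of size $n$, and $\mathsf{BNC}(1)$ is spanned by the polygon of size $1$ with unlabeled arc. The partial composition $\mathfrak{c}\circ_i\mathfrak{d}$ (with $\mathfrak{d}$ of arity $m$) glues the base of $\mathfrak{d}$ onto the $i$th edge of $\mathfrak{c}$; the arc $(i,i+m)$ becomes dotted if both glued arcs are unlabeled, thick if both are thick, and unlabeled otherwise. Let $\mathcal{M}_{\mathsf{BNC}} := \{\mathds{1}, \mathtt{a}, \mathtt{b}\}$ be the unitary magma with unit $\mathds{1}$, where $\mathtt{a}\star\mathtt{a}=\mathtt{a}$, $\mathtt{b}\star\mathtt{b}=\mathtt{b}$, and $\mathtt{a}\star\mathtt{b}=\mathtt{b}\star\mathtt{a}=\mathds{1}$ (commutative, not associative). Let $\phi_{\mathsf{BNC}} : \mathsf{BNC} \to \mathrm{NC}\mathcal{M}_{\mathsf{BNC}}$ be the linear map sending a bicolored noncrossing configuration $\mathfrak{c}$ to the noncrossing $\mathcal{M}_{\mathsf{BNC}}$-clique obtained by labeling all thick arcs of $\mathfrak{c}$ by $\mathtt{a}$, all dotted diagonals by $\mathtt{b}$, all unlabeled edges and the base (if unlabeled) by $\mathtt{b}$, and all unlabeled diagonals by $\mathds{1}$. -}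

module Defs where

-- Encoding conventions:
--  * An object of arity n (n ≥ 1) is drawn on a polygon with n+1 vertices
--    numbered 0,1,…,n (0-based; the paper's vertex k is our vertex k-1).
--  * Arcs are pairs (x , y) with x < y ≤ n. The base is (0 , n), the j-th
--    edge (1 ≤ j ≤ n) is (j-1 , j), all other arcs are diagonals.
--  * A decoration of arcs is stored as a raw function ℕ → ℕ → A; only the
--    values at genuine arcs matter, and two raw functions are identified
--    when they agree on all arcs ('Agree n').

open import Data.Nat using (ℕ; zero; suc; _+_; _∸_; _≤_; _<_; _≤ᵇ_; _≡ᵇ_)
open import Data.Bool using (Bool; true; false; if_then_else_; _∧_; _∨_)
open import Data.Maybe using (Maybe; just; nothing)
open import Data.Product using (_×_)
open import Data.Sum using (_⊎_)
open import Data.Empty using (⊥)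
open import Relation.Nullary using (¬_)
open import Relation.Binary.PropositionalEquality using (_≡_; _≢_)

Deco : Set → Set
Deco A = ℕ → ℕ → A

Agree : {A : Set} → ℕ → Deco A → Deco A → Set
Agree n f g = ∀ x y → x < y → y ≤ n → f x y ≡ g x y

-- no two present arcs cross (crossing arcs are automatically diagonals)
NonCrossing : {A : Set} → (A → Set) → ℕ → Deco A → Set
NonCrossing {A} Present n f =
  ∀ x y z w → x < z → z < y → y < w → w ≤ n →
  Present (f x y) → Present (f z w) → ⊥

IsDiagonal : ℕ → ℕ → ℕ → Set
IsDiagonal n x y = (suc x < y) × ¬ ((x ≡ 0) × (y ≡ n))

-- Generic gluing: glue the base of g (arity m) onto the i-th edge of f
-- (arity n).  The result has arity n + m ∸ 1.  'absent' decorates the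
-- arcs joining an inner vertex of g to an outer vertex of f, and
-- 'glue' computes the decoration of the common arc from the decoration
-- of the i-th edge of f and of the base of g.

glueDeco : {A : Set} → A → (A → A → A) →
           ℕ → ℕ → Deco A → ℕ → Deco A → Deco A
glueDeco {A} absent glue n m f i g x y =
  if (x ≡ᵇ s) ∧ (y ≡ᵇ t) then glue (f s i) (g 0 m)
  else if (s ≤ᵇ x) ∧ (y ≤ᵇ t) then g (x ∸ s) (y ∸ s)
  else both (back x) (back y)
  where
  s = i ∸ 1          -- position of vertex 0 of g in the result
  t = s + m          -- position of vertex m of g in the result
  back : ℕ → Maybe ℕ -- vertex of the result ↦ vertex of f (if any)
  back v = if v ≤ᵇ s then just v
           else if t ≤ᵇ v then just (v ∸ (m ∸ 1))
           else nothing
  both : Maybe ℕ → Maybe ℕ → A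
  both (just u) (just v) = f u v
  both _ _ = absent

data M : Set where
  𝟙 a b : M

_⋆_ : M → M → M
𝟙 ⋆ y = y
a ⋆ 𝟙 = a
a ⋆ a = a
a ⋆ b = 𝟙
b ⋆ 𝟙 = b
b ⋆ a = 𝟙
b ⋆ b = b

Solid : M → Set
Solid x = x ≢ 𝟙

-- noncrossing M_BNC-cliques of arity n; the arity-1 clique is the unit,
-- i.e. the segment whose single arc is unlabeled (labeled 𝟙)
IsNCClique : ℕ → Deco M → Set
IsNCClique n p = (1 ≤ n) × (n ≡ 1 → p 0 1 ≡ 𝟙) × NonCrossing Solid n p

compNC : ℕ → ℕ → Deco M → ℕ → Deco M → Deco M
compNC = glueDeco 𝟙 _⋆_

unitNC : Deco M
unitNC _ _ = 𝟙

EdgesAndBaseSolid : ℕ → Deco M → Set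
EdgesAndBaseSolid n p = Solid (p 0 n) × (∀ j → j < n → Solid (p j (suc j)))

InSub : ℕ → Deco M → Set
InSub n p = IsNCClique n p × ((n ≡ 1) ⊎ EdgesAndBaseSolid n p)

data Col : Set where
  none thick dotted : Col

Present : Col → Set
Present c = c ≢ none

IsBNC : ℕ → Deco Col → Set
IsBNC n c =
  (1 ≤ n) ×
  (n ≡ 1 → c 0 1 ≡ none) ×
  NonCrossing Present n c ×
  (∀ x y → x < y → y ≤ n → c x y ≡ dotted → IsDiagonal n x y)

combine : Col → Col → Col
combine none none = dotted
combine thick thick = thick
combine _ _ = none

compBNC : ℕ → ℕ → Deco Col → ℕ → Deco Col → Deco Col
compBNC 1 m c i d = d
compBNC n 1 c i d = c
compBNC n m c i d = glueDeco none combine n m c i d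

unitBNC : Deco Col
unitBNC _ _ = none

isEdgeOrBase : ℕ → ℕ → ℕ → Bool
isEdgeOrBase n x y = (suc x ≡ᵇ y) ∨ ((x ≡ᵇ 0) ∧ (y ≡ᵇ n))

φBNC : ℕ → Deco Col → Deco M
φBNC 1 c x y = 𝟙
φBNC n c x y with c x y
... | thick  = a
... | dotted = b
... | none   = if isEdgeOrBase n x y then b else 𝟙

-- Gluing q onto the i-th edge of p sorts the arcs of p ∘ᵢ q into four kinds: the glued arc,
-- the arcs of q, the arcs of p (its vertices renumbered by the order-preserving map bk), and the
-- arcs crossing the glued arc, which are absent. Noncrossingness and the solidity of edges and
-- base pass from p and q to p ∘ᵢ q along this classification.
-- φ_BNC labels an arc by a function arcLabel of its colour and of whether it is an edge or the
-- base. Edges and bases of a configuration are never dotted, so arcLabel can be inverted on the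
-- relevant arcs and φ_BNC is bijective. It commutes with gluing because the classification
-- preserves being an edge or the base, except for the glued arc, which becomes a diagonal; there
-- the rule of combine matches ⋆ on labels of edges and bases: b ⋆ b = b (two unlabeled arcs give
-- a dotted one), a ⋆ a = a (two thick arcs give a thick one), a ⋆ b = 𝟙 (otherwise unlabeled).
module Submission where

open import Defs
open import Data.Bool using (Bool; true; false; if_then_else_; _∧_)
open import Data.Empty using (⊥)
open import Data.Maybe using (Maybe; just; nothing)
open import Data.Nat
open import Data.Nat.Properties
open import Data.Product using (Σ; _×_; _,_; proj₁; proj₂)
open import Data.Sum using (_⊎_; inj₁; inj₂; map₂)
open import Function using (_∘_)
open import Relation.Nullary using (¬_; Dec; contradiction; yes; no)
open import Relation.Nullary.Decidable using (_×-dec_)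
open import Relation.Nullary.Reflects
  using (Reflects; ofʸ; ofⁿ; det; invert; fromEquivalence; _×-reflects_; _⊎-reflects_)
open import Relation.Binary.PropositionalEquality

≡ᵇ-reflects-≡ : ∀ m n → Reflects (m ≡ n) (m ≡ᵇ n)
≡ᵇ-reflects-≡ m n = fromEquivalence (≡ᵇ⇒≡ m n) (≡⇒≡ᵇ m n)

reflects-cong : ∀ {P Q : Set} {b c} → Reflects P b → Reflects Q c → (P → Q) → (Q → P) → b ≡ c
reflects-cong (ofʸ _)  (ofʸ _)  _  _    = refl
reflects-cong (ofʸ p)  (ofⁿ ¬q) to _    = contradiction (to p) ¬q
reflects-cong (ofⁿ ¬p) (ofʸ q)  _  from = contradiction (from q) ¬p
reflects-cong (ofⁿ _)  (ofⁿ _)  _  _    = refl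

Crosses : ℕ → ℕ → ℕ → ℕ → Set
Crosses x y z w = x < z × z < y × y < w

IsEdgeOrBase : ℕ → ℕ → ℕ → Set
IsEdgeOrBase n x y = suc x ≡ y ⊎ (x ≡ 0 × y ≡ n)

isEdgeOrBase-reflects : ∀ n x y → Reflects (IsEdgeOrBase n x y) (isEdgeOrBase n x y)
isEdgeOrBase-reflects n x y =
  ≡ᵇ-reflects-≡ (suc x) y ⊎-reflects (≡ᵇ-reflects-≡ x 0 ×-reflects ≡ᵇ-reflects-≡ y n)

module _ {n x y : ℕ} where

  isEdgeOrBase-true : IsEdgeOrBase n x y → isEdgeOrBase n x y ≡ true
  isEdgeOrBase-true = det (isEdgeOrBase-reflects n x y) ∘ ofʸ

  isEdgeOrBase-false : ¬ IsEdgeOrBase n x y → isEdgeOrBase n x y ≡ false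
  isEdgeOrBase-false = det (isEdgeOrBase-reflects n x y) ∘ ofⁿ

  isEdgeOrBase-true⁻¹ : isEdgeOrBase n x y ≡ true → IsEdgeOrBase n x y
  isEdgeOrBase-true⁻¹ e = invert (subst (Reflects _) e (isEdgeOrBase-reflects n x y))

  isEdgeOrBase-false⁻¹ : isEdgeOrBase n x y ≡ false → ¬ IsEdgeOrBase n x y
  isEdgeOrBase-false⁻¹ e = invert (subst (Reflects _) e (isEdgeOrBase-reflects n x y))

isEdgeOrBase-cong : ∀ {n x y n′ x′ y′} →
  (IsEdgeOrBase n x y → IsEdgeOrBase n′ x′ y′) → (IsEdgeOrBase n′ x′ y′ → IsEdgeOrBase n x y) →
  isEdgeOrBase n x y ≡ isEdgeOrBase n′ x′ y′
isEdgeOrBase-cong = reflects-cong (isEdgeOrBase-reflects _ _ _) (isEdgeOrBase-reflects _ _ _)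

edgeOrBase⇒¬diagonal : ∀ {n x y} → IsEdgeOrBase n x y → ¬ IsDiagonal n x y
edgeOrBase⇒¬diagonal (inj₁ refl) (sx<sx , _) = <-irrefl refl sx<sx
edgeOrBase⇒¬diagonal (inj₂ base) (_ , ¬base) = ¬base base

¬edgeOrBase⇒diagonal : ∀ {n x y} → x < y → ¬ IsEdgeOrBase n x y → IsDiagonal n x y
¬edgeOrBase⇒diagonal x<y ¬eb = ≤∧≢⇒< x<y (¬eb ∘ inj₁) , ¬eb ∘ inj₂

crossing⇒¬edgeOrBaseˡ : ∀ {n x y z w} → Crosses x y z w → w ≤ n → ¬ IsEdgeOrBase n x y
crossing⇒¬edgeOrBaseˡ (x<z , z<y , _)   _   (inj₁ refl)       = <⇒≱ x<z (≤-pred z<y)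
crossing⇒¬edgeOrBaseˡ (_ , _ , y<w)     w≤n (inj₂ (_ , refl)) = <⇒≱ y<w w≤n

crossing⇒¬edgeOrBaseʳ : ∀ {n x y z w} → Crosses x y z w → w ≤ n → ¬ IsEdgeOrBase n z w
crossing⇒¬edgeOrBaseʳ (_ , z<y , y<w) _ (inj₁ refl)       = <⇒≱ z<y (≤-pred y<w)
crossing⇒¬edgeOrBaseʳ (x<z , _ , _)   _ (inj₂ (refl , _)) = <⇒≱ x<z z≤n

shiftEdge⁺ : ∀ {k x y} → k ≤ x → suc x ≡ y → suc (x ∸ k) ≡ y ∸ k
shiftEdge⁺ k≤x refl = sym (+-∸-assoc 1 k≤x)

shiftEdge⁻ : ∀ {k x y} → k ≤ x → k ≤ y → suc (x ∸ k) ≡ y ∸ k → suc x ≡ y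
shiftEdge⁻ k≤x k≤y e = ∸-cancelʳ-≡ (m≤n⇒m≤1+n k≤x) k≤y (trans (+-∸-assoc 1 k≤x) e)

-- Partial composition ∘ (suc s) of an arity-n polygon with an arity-(suc m1) one: the latter
-- occupies the vertices s … t of the result, and bk renumbers the others as vertices of the former.
module Glue (n m1 s : ℕ) where

  t : ℕ
  t = s + suc m1

  N : ℕ
  N = n + suc m1 ∸ 1

  N≡n+m1 : N ≡ n + m1
  N≡n+m1 = cong (_∸ 1) (+-suc n m1)

  s<t : s < t
  s<t = m<m+n s z<s

  m1≤t : m1 ≤ t
  m1≤t = ≤-trans (n≤1+n m1) (m≤n+m (suc m1) s)

  t∸m1≡1+s : t ∸ m1 ≡ suc s
  t∸m1≡1+s = trans (cong (_∸ m1) (+-suc s m1)) (m+n∸n≡m (suc s) m1)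

  N∸m1≡n : N ∸ m1 ≡ n
  N∸m1≡n = trans (cong (_∸ m1) N≡n+m1) (m+n∸n≡m n m1)

  t≤N : s < n → t ≤ N
  t≤N s<n = subst₂ _≤_ (sym (+-suc s m1)) (sym N≡n+m1) (+-monoˡ-≤ m1 s<n)

  n≤N : n ≤ N
  n≤N = subst (n ≤_) (sym N≡n+m1) (m≤m+n n m1)

  1+s<t : 1 ≤ m1 → suc s < t
  1+s<t 1≤m1 = subst (suc s <_) (sym (+-suc s m1)) (s≤s (m<m+n s 1≤m1))

  1+m1<N : 2 ≤ n → suc m1 < N
  1+m1<N 2≤n = subst (suc (suc m1) ≤_) (sym N≡n+m1) (+-monoˡ-≤ m1 2≤n)

  ∸s≤1+m1 : ∀ {y} → y ≤ t → y ∸ s ≤ suc m1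
  ∸s≤1+m1 {y} y≤t = subst (y ∸ s ≤_) (m+n∸m≡n s (suc m1)) (∸-monoˡ-≤ s y≤t)

  Out : ℕ → Set
  Out v = v ≤ s ⊎ t ≤ v

  between⇒¬Out : ∀ {v} → s < v → v < t → ¬ Out v
  between⇒¬Out s<v _   (inj₁ v≤s) = <⇒≱ s<v v≤s
  between⇒¬Out _   v<t (inj₂ t≤v) = <⇒≱ v<t t≤v

  IsGlued : ℕ → ℕ → Set
  IsGlued x y = x ≡ s × y ≡ t

  data Position (x y : ℕ) : Set where
    glued    : x ≡ s → y ≡ t → Position x y
    inner    : s ≤ x → y ≤ t → ¬ IsGlued x y → Position x y
    outer    : Out x → Out y → ¬ IsGlued x y → Position x y
    crossing : Crosses s t x y ⊎ Crosses x y s t → Position x y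

  position-¬glued : ∀ {x y} → x < y → ¬ IsGlued x y → Position x y
  position-¬glued {x} {y} x<y ng with x ≤? s
  ... | yes x≤s with y ≤? s
  ...   | yes y≤s = outer (inj₁ x≤s) (inj₁ y≤s) ng
  ...   | no y≰s with t ≤? y
  ...     | yes t≤y = outer (inj₁ x≤s) (inj₂ t≤y) ng
  ...     | no t≰y with m≤n⇒m<n∨m≡n x≤s
  ...       | inj₁ x<s = crossing (inj₂ (x<s , ≰⇒> y≰s , ≰⇒> t≰y))
  ...       | inj₂ refl = inner ≤-refl (<⇒≤ (≰⇒> t≰y)) ng
  position-¬glued {x} {y} x<y ng | no x≰s with t ≤? x
  ... | yes t≤x = outer (inj₂ t≤x) (inj₂ (≤-trans t≤x (<⇒≤ x<y))) ng
  ... | no t≰x with y ≤? t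
  ...   | yes y≤t = inner (<⇒≤ (≰⇒> x≰s)) y≤t ng
  ...   | no y≰t = crossing (inj₁ (≰⇒> x≰s , ≰⇒> t≰x , ≰⇒> y≰t))

  position : ∀ {x y} → x < y → Position x y
  position {x} {y} x<y with x ≟ s | y ≟ t
  ... | yes x≡s | yes y≡t = glued x≡s y≡t
  ... | yes _   | no y≢t  = position-¬glued x<y (y≢t ∘ proj₂)
  ... | no x≢s  | _       = position-¬glued x<y (x≢s ∘ proj₁)

  bk : ℕ → ℕ
  bk v = if v ≤ᵇ s then v else v ∸ m1

  bk-left : ∀ {v} → v ≤ s → bk v ≡ v
  bk-left {v} v≤s rewrite det (≤ᵇ-reflects-≤ v s) (ofʸ v≤s) = refl

  bk-right : ∀ {v} → t ≤ v → bk v ≡ v ∸ m1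
  bk-right {v} t≤v rewrite det (≤ᵇ-reflects-≤ v s) (ofⁿ (<⇒≱ (<-≤-trans s<t t≤v))) = refl

  s<∸m1 : ∀ {v} → t ≤ v → s < v ∸ m1
  s<∸m1 {v} t≤v = subst (_≤ v ∸ m1) t∸m1≡1+s (∸-monoˡ-≤ m1 t≤v)

  bk-mono : ∀ {u v} → Out u → Out v → u < v → bk u < bk v
  bk-mono (inj₁ u≤s) (inj₁ v≤s) u<v rewrite bk-left u≤s | bk-left v≤s = u<v
  bk-mono (inj₁ u≤s) (inj₂ t≤v) _   rewrite bk-left u≤s | bk-right t≤v = ≤-<-trans u≤s (s<∸m1 t≤v)
  bk-mono (inj₂ t≤u) (inj₁ v≤s) u<v = contradiction (≤-trans t≤u (<⇒≤ u<v)) (<⇒≱ (≤-<-trans v≤s s<t))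
  bk-mono (inj₂ t≤u) (inj₂ t≤v) u<v rewrite bk-right t≤u | bk-right t≤v =
    ∸-monoˡ-< u<v (≤-trans m1≤t t≤u)

  bk-bound : ∀ {v} → s < n → Out v → v ≤ N → bk v ≤ n
  bk-bound s<n (inj₁ v≤s) _ rewrite bk-left v≤s = <⇒≤ (≤-<-trans v≤s s<n)
  bk-bound s<n (inj₂ t≤v) v≤N rewrite bk-right t≤v = subst (_ ≤_) N∸m1≡n (∸-monoˡ-≤ m1 v≤N)

  -- The local function back of glueDeco, restated so that rewriting can reach it.
  back : ℕ → Maybe ℕ
  back v = if v ≤ᵇ s then just v else if t ≤ᵇ v then just (v ∸ m1) else nothing

  back-outer : ∀ {v} → Out v → back v ≡ just (bk v)
  back-outer {v} (inj₁ v≤s) rewrite det (≤ᵇ-reflects-≤ v s) (ofʸ v≤s) = refl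
  back-outer {v} (inj₂ t≤v)
    rewrite det (≤ᵇ-reflects-≤ v s) (ofⁿ (<⇒≱ (<-≤-trans s<t t≤v)))
          | det (≤ᵇ-reflects-≤ t v) (ofʸ t≤v) = refl

  back-between : ∀ {v} → s < v → v < t → back v ≡ nothing
  back-between {v} s<v v<t
    rewrite det (≤ᵇ-reflects-≤ v s) (ofⁿ (<⇒≱ s<v))
          | det (≤ᵇ-reflects-≤ t v) (ofⁿ (<⇒≱ v<t)) = refl

  glued-reflects : ∀ x y → Reflects (IsGlued x y) ((x ≡ᵇ s) ∧ (y ≡ᵇ t))
  glued-reflects x y = ≡ᵇ-reflects-≡ x s ×-reflects ≡ᵇ-reflects-≡ y t

  within-reflects : ∀ x y → Reflects (s ≤ x × y ≤ t) ((s ≤ᵇ x) ∧ (y ≤ᵇ t))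
  within-reflects x y = ≤ᵇ-reflects-≤ s x ×-reflects ≤ᵇ-reflects-≤ y t

  ¬glued-base : 2 ≤ n → ¬ IsGlued 0 N
  ¬glued-base 2≤n (0≡s , N≡t) = <-irrefl (sym (trans N≡t (cong (_+ suc m1) (sym 0≡s)))) (1+m1<N 2≤n)

  edge-¬glued : 1 ≤ m1 → ∀ {j} → ¬ IsGlued j (suc j)
  edge-¬glued 1≤m1 (refl , 1+s≡t) = <-irrefl 1+s≡t (1+s<t 1≤m1)

  outer⇒¬within : ∀ {x y} → x < y → Out x → Out y → ¬ IsGlued x y → ¬ (s ≤ x × y ≤ t)
  outer⇒¬within _   (inj₁ x≤s) (inj₂ t≤y) ng (s≤x , y≤t) = ng (≤-antisym x≤s s≤x , ≤-antisym y≤t t≤y)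
  outer⇒¬within x<y _          (inj₁ y≤s) _  (s≤x , _)   = <⇒≱ x<y (≤-trans y≤s s≤x)
  outer⇒¬within x<y (inj₂ t≤x) _          _  (_ , y≤t)   = <⇒≱ x<y (≤-trans y≤t t≤x)

  module Values {A : Set} (absent : A) (glue : A → A → A) (f g : Deco A) where

    G : Deco A
    G = glueDeco absent glue n (suc m1) f (suc s) g

    G-glued : G s t ≡ glue (f s (suc s)) (g 0 (suc m1))
    G-glued rewrite det (glued-reflects s t) (ofʸ (refl , refl)) = refl

    G-inner : ∀ {x y} → s ≤ x → y ≤ t → ¬ IsGlued x y → G x y ≡ g (x ∸ s) (y ∸ s)
    G-inner {x} {y} s≤x y≤t ng
      rewrite det (glued-reflects x y) (ofⁿ ng)
            | det (within-reflects x y) (ofʸ (s≤x , y≤t)) = refl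

    G-outer : ∀ {x y} → x < y → Out x → Out y → ¬ IsGlued x y → G x y ≡ f (bk x) (bk y)
    G-outer {x} {y} x<y ox oy ng
      rewrite det (glued-reflects x y) (ofⁿ ng)
            | det (within-reflects x y) (ofⁿ (outer⇒¬within x<y ox oy ng))
            | back-outer ox | back-outer oy = refl

    G-crossing : ∀ {x y} → Crosses s t x y ⊎ Crosses x y s t → G x y ≡ absent
    G-crossing {x} {y} (inj₁ (s<x , x<t , t<y))
      rewrite det (glued-reflects x y) (ofⁿ (λ (_ , y≡t) → <⇒≢ t<y (sym y≡t)))
            | det (within-reflects x y) (ofⁿ (λ (_ , y≤t) → <⇒≱ t<y y≤t))
            | back-between s<x x<t = refl
    G-crossing {x} {y} (inj₂ (x<s , s<y , y<t))
      rewrite det (glued-reflects x y) (ofⁿ (λ (x≡s , _) → <⇒≢ x<s x≡s))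
            | det (within-reflects x y) (ofⁿ (λ (s≤x , _) → <⇒≱ x<s s≤x))
            | back-outer (inj₁ (<⇒≤ x<s)) | back-between s<y y<t = refl

    G-noncrossing : (Pr : A → Set) → ¬ Pr absent → s < n →
      NonCrossing Pr n f → NonCrossing Pr (suc m1) g → NonCrossing Pr N G
    G-noncrossing Pr ¬absent s<n ncf ncg x y z w x<z z<y y<w w≤N Pxy Pzw =
      go (position (<-trans x<z z<y)) (position (<-trans z<y y<w))
      where
      go : Position x y → Position z w → ⊥
      go (crossing c) _ = ¬absent (subst Pr (G-crossing c) Pxy)
      go _ (crossing c) = ¬absent (subst Pr (G-crossing c) Pzw)
      go (glued refl _) (glued refl _) = <-irrefl refl x<z
      go (glued _ refl) (inner _ w≤t _) = <⇒≱ y<w w≤t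
      go (glued refl refl) (outer oz _ _) = between⇒¬Out x<z z<y oz
      go (inner s≤x _ _) (glued refl _) = <⇒≱ x<z s≤x
      go (inner s≤x y≤t _) (outer oz _ _) = between⇒¬Out (≤-<-trans s≤x x<z) (<-≤-trans z<y y≤t) oz
      go (outer _ oy _) (glued refl refl) = between⇒¬Out z<y y<w oy
      go (outer _ oy _) (inner s≤z w≤t _) = between⇒¬Out (≤-<-trans s≤z z<y) (<-≤-trans y<w w≤t) oy
      go (inner s≤x y≤t ng₁) (inner s≤z w≤t ng₂) =
        ncg (x ∸ s) (y ∸ s) (z ∸ s) (w ∸ s)
          (∸-monoˡ-< x<z s≤x) (∸-monoˡ-< z<y s≤z) (∸-monoˡ-< y<w (≤-trans s≤z (<⇒≤ z<y)))
          (∸s≤1+m1 w≤t) (subst Pr (G-inner s≤x y≤t ng₁) Pxy) (subst Pr (G-inner s≤z w≤t ng₂) Pzw)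
      go (outer ox oy ng₁) (outer oz ow ng₂) =
        ncf (bk x) (bk y) (bk z) (bk w)
          (bk-mono ox oz x<z) (bk-mono oz oy z<y) (bk-mono oy ow y<w) (bk-bound s<n ow w≤N)
          (subst Pr (G-outer (<-trans x<z z<y) ox oy ng₁) Pxy)
          (subst Pr (G-outer (<-trans z<y y<w) oz ow ng₂) Pzw)

    G-base : 2 ≤ n → s < n → G 0 N ≡ f 0 n
    G-base 2≤n s<n = begin
      G 0 N            ≡⟨ G-outer (<-trans z<s (1+m1<N 2≤n)) (inj₁ z≤n) (inj₂ (t≤N s<n)) (¬glued-base 2≤n) ⟩
      f (bk 0) (bk N)  ≡⟨ cong₂ f (bk-left z≤n) (trans (bk-right (t≤N s<n)) N∸m1≡n) ⟩
      f 0 n            ∎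
      where open ≡-Reasoning

    G-edge : 1 ≤ m1 → s < n → ∀ j → j < N →
      (Σ ℕ λ k → k < suc m1 × G j (suc j) ≡ g k (suc k)) ⊎
      (Σ ℕ λ k → k < n × G j (suc j) ≡ f k (suc k))
    G-edge 1≤m1 s<n j j<N with suc j ≤? s | t ≤? j
    ... | yes j<s | _ =
      inj₂ (j , <-trans j<s s<n ,
            trans (G-outer (n<1+n j) (inj₁ (<⇒≤ j<s)) (inj₁ j<s) (edge-¬glued 1≤m1))
                  (cong₂ f (bk-left (<⇒≤ j<s)) (bk-left j<s)))
    ... | no _ | yes t≤j =
      inj₂ (j ∸ m1 , subst (j ∸ m1 <_) N∸m1≡n (∸-monoˡ-< j<N m1≤j) ,
            trans (G-outer (n<1+n j) (inj₂ t≤j) (inj₂ (m≤n⇒m≤1+n t≤j)) (edge-¬glued 1≤m1))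
                  (cong₂ f (bk-right t≤j) (trans (bk-right (m≤n⇒m≤1+n t≤j)) (+-∸-assoc 1 m1≤j))))
      where
      m1≤j : m1 ≤ j
      m1≤j = ≤-trans m1≤t t≤j
    ... | no j≮s | no t≰j =
      inj₁ (j ∸ s , subst (_≤ suc m1) (+-∸-assoc 1 s≤j) (∸s≤1+m1 (≰⇒> t≰j)) ,
            trans (G-inner s≤j (≰⇒> t≰j) (edge-¬glued 1≤m1)) (cong (g (j ∸ s)) (+-∸-assoc 1 s≤j)))
      where
      s≤j : s ≤ j
      s≤j = ≤-pred (≰⇒> j≮s)

  module _ (2≤n : 2 ≤ n) (1≤m1 : 1 ≤ m1) (s<n : s < n) where

    glued-¬edgeOrBase : ¬ IsEdgeOrBase N s t
    glued-¬edgeOrBase (inj₁ 1+s≡t)      = edge-¬glued 1≤m1 (refl , 1+s≡t)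
    glued-¬edgeOrBase (inj₂ (s≡0 , t≡N)) = ¬glued-base 2≤n (sym s≡0 , sym t≡N)

    inner-edgeOrBase : ∀ {x y} → x < y → s ≤ x → y ≤ t → ¬ IsGlued x y →
      isEdgeOrBase N x y ≡ isEdgeOrBase (suc m1) (x ∸ s) (y ∸ s)
    inner-edgeOrBase {x} {y} x<y s≤x y≤t ng = isEdgeOrBase-cong to from
      where
      s≤y : s ≤ y
      s≤y = ≤-trans s≤x (<⇒≤ x<y)
      to : IsEdgeOrBase N x y → IsEdgeOrBase (suc m1) (x ∸ s) (y ∸ s)
      to (inj₁ e) = inj₁ (shiftEdge⁺ s≤x e)
      to (inj₂ (refl , refl)) =
        contradiction (subst (λ k → N ≤ k + suc m1) (n≤0⇒n≡0 s≤x) y≤t) (<⇒≱ (1+m1<N 2≤n))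
      from : IsEdgeOrBase (suc m1) (x ∸ s) (y ∸ s) → IsEdgeOrBase N x y
      from (inj₁ e) = inj₁ (shiftEdge⁻ s≤x s≤y e)
      from (inj₂ (x∸s≡0 , y∸s≡1+m1)) =
        contradiction (≤-antisym (m∸n≡0⇒m≤n x∸s≡0) s≤x ,
                       ∸-cancelʳ-≡ s≤y (m≤m+n s (suc m1)) (trans y∸s≡1+m1 (sym (m+n∸m≡n s (suc m1)))))
                      ng

    crossing⇒¬edgeOrBase : ∀ {x y} → y ≤ N → Crosses s t x y ⊎ Crosses x y s t → ¬ IsEdgeOrBase N x y
    crossing⇒¬edgeOrBase y≤N (inj₁ cr) = crossing⇒¬edgeOrBaseʳ cr y≤N
    crossing⇒¬edgeOrBase _   (inj₂ cr) = crossing⇒¬edgeOrBaseˡ cr (t≤N s<n)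

    edgeOrBase-left : ∀ {x y} → y ≤ s → isEdgeOrBase N x y ≡ isEdgeOrBase n x y
    edgeOrBase-left {x} {y} y≤s = isEdgeOrBase-cong to from
      where
      y<n : y < n
      y<n = ≤-<-trans y≤s s<n
      to : IsEdgeOrBase N x y → IsEdgeOrBase n x y
      to (inj₁ e)          = inj₁ e
      to (inj₂ (_ , refl)) = contradiction n≤N (<⇒≱ y<n)
      from : IsEdgeOrBase n x y → IsEdgeOrBase N x y
      from (inj₁ e)          = inj₁ e
      from (inj₂ (_ , refl)) = contradiction y<n (<-irrefl refl)

    edgeOrBase-straddling : ∀ {x y} → x ≤ s → t ≤ y → ¬ IsGlued x y →
      isEdgeOrBase N x y ≡ isEdgeOrBase n x (y ∸ m1)
    edgeOrBase-straddling {x} {y} x≤s t≤y ng = isEdgeOrBase-cong to from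
      where
      m1≤y : m1 ≤ y
      m1≤y = ≤-trans m1≤t t≤y
      to : IsEdgeOrBase N x y → IsEdgeOrBase n x (y ∸ m1)
      to (inj₁ refl)         = contradiction t≤y (<⇒≱ (≤-<-trans (s≤s x≤s) (1+s<t 1≤m1)))
      to (inj₂ (x≡0 , refl)) = inj₂ (x≡0 , N∸m1≡n)
      from : IsEdgeOrBase n x (y ∸ m1) → IsEdgeOrBase N x y
      from (inj₁ e) = contradiction (x≡s , ∸-cancelʳ-≡ m1≤y m1≤t y∸m1≡t∸m1) ng
        where
        x≡s : x ≡ s
        x≡s = ≤-antisym x≤s (≤-pred (subst (suc s ≤_) (sym e) (s<∸m1 t≤y)))
        y∸m1≡t∸m1 : y ∸ m1 ≡ t ∸ m1
        y∸m1≡t∸m1 = trans (sym e) (trans (cong suc x≡s) (sym t∸m1≡1+s))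
      from (inj₂ (x≡0 , y∸m1≡n)) =
        inj₂ (x≡0 , ∸-cancelʳ-≡ m1≤y (≤-trans m1≤t (t≤N s<n)) (trans y∸m1≡n (sym N∸m1≡n)))

    edgeOrBase-right : ∀ {x y} → t ≤ x → t ≤ y → isEdgeOrBase N x y ≡ isEdgeOrBase n (x ∸ m1) (y ∸ m1)
    edgeOrBase-right {x} {y} t≤x t≤y = isEdgeOrBase-cong to from
      where
      m1≤x : m1 ≤ x
      m1≤x = ≤-trans m1≤t t≤x
      to : IsEdgeOrBase N x y → IsEdgeOrBase n (x ∸ m1) (y ∸ m1)
      to (inj₁ e)          = inj₁ (shiftEdge⁺ m1≤x e)
      to (inj₂ (refl , _)) = contradiction t≤x (<⇒≱ (≤-<-trans z≤n s<t))
      from : IsEdgeOrBase n (x ∸ m1) (y ∸ m1) → IsEdgeOrBase N x y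
      from (inj₁ e)             = inj₁ (shiftEdge⁻ m1≤x (≤-trans m1≤t t≤y) e)
      from (inj₂ (x∸m1≡0 , _)) = contradiction (subst (s <_) x∸m1≡0 (s<∸m1 t≤x)) n≮0

    outer-edgeOrBase : ∀ {x y} → x < y → Out x → Out y → ¬ IsGlued x y →
      isEdgeOrBase N x y ≡ isEdgeOrBase n (bk x) (bk y)
    outer-edgeOrBase _ (inj₁ x≤s) (inj₁ y≤s) _ =
      trans (edgeOrBase-left y≤s) (cong₂ (isEdgeOrBase n) (sym (bk-left x≤s)) (sym (bk-left y≤s)))
    outer-edgeOrBase _ (inj₁ x≤s) (inj₂ t≤y) ng =
      trans (edgeOrBase-straddling x≤s t≤y ng)
            (cong₂ (isEdgeOrBase n) (sym (bk-left x≤s)) (sym (bk-right t≤y)))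
    outer-edgeOrBase x<y (inj₂ t≤x) (inj₁ y≤s) _ =
      contradiction (≤-trans t≤x (<⇒≤ x<y)) (<⇒≱ (≤-<-trans y≤s s<t))
    outer-edgeOrBase _ (inj₂ t≤x) (inj₂ t≤y) _ =
      trans (edgeOrBase-right t≤x t≤y) (cong₂ (isEdgeOrBase n) (sym (bk-right t≤x)) (sym (bk-right t≤y)))

module _ {A : Set} (absent : A) (glue : A → A → A) (f g : Deco A) where

  glue-identityˡ : ∀ m1 → glue (f 0 1) (g 0 (suc m1)) ≡ g 0 (suc m1) →
    Agree (suc m1) g (Glue.Values.G 1 m1 0 absent glue f g)
  glue-identityˡ m1 unitˡ x y _ y≤m = sym (go ((x ≟ 0) ×-dec (y ≟ suc m1)))
    where
    open Glue 1 m1 0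
    open Values absent glue f g
    go : Dec (IsGlued x y) → G x y ≡ g x y
    go (yes (refl , refl)) = trans G-glued unitˡ
    go (no ng) = G-inner z≤n y≤m ng

  glue-identityʳ : ∀ n s → glue (f s (suc s)) (g 0 1) ≡ f s (suc s) →
    Agree n f (Glue.Values.G n 0 s absent glue f g)
  glue-identityʳ n s unitʳ x y x<y _ = sym (go ((x ≟ s) ×-dec (y ≟ s + 1)))
    where
    open Glue n 0 s
    open Values absent glue f g
    out : ∀ v → Out v
    out v with v ≤? s
    ... | yes v≤s = inj₁ v≤s
    ... | no v≰s = inj₂ (subst (_≤ v) (+-comm 1 s) (≰⇒> v≰s))
    bk-id : ∀ v → bk v ≡ v
    bk-id v with v ≤ᵇ s
    ... | true = refl
    ... | false = refl
    go : Dec (IsGlued x y) → G x y ≡ f x y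
    go (yes (refl , refl)) = trans G-glued (trans unitʳ (cong (f s) (+-comm 1 s)))
    go (no ng) = trans (G-outer x<y (out x) (out y) ng) (cong₂ f (bk-id x) (bk-id y))

⋆-identityʳ : ∀ x → x ⋆ 𝟙 ≡ x
⋆-identityʳ 𝟙 = refl
⋆-identityʳ a = refl
⋆-identityʳ b = refl

inSub-unit : InSub 1 unitNC
inSub-unit = (≤-refl , (λ _ → refl) , λ _ _ _ _ _ _ _ _ 𝟙≢𝟙 _ → 𝟙≢𝟙 refl) , inj₁ refl

InSub-resp-Agree : ∀ {n p p′} → Agree n p p′ → InSub n p → InSub n p′
InSub-resp-Agree {n} {p} {p′} p≈p′ ((1≤n , unit , ncp) , edgesAndBase) =
  (1≤n , unit′ , nc′) , map₂ transport edgesAndBase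
  where
  unit′ : n ≡ 1 → p′ 0 1 ≡ 𝟙
  unit′ refl = trans (sym (p≈p′ 0 1 ≤-refl ≤-refl)) (unit refl)
  nc′ : NonCrossing Solid n p′
  nc′ x y z w x<z z<y y<w w≤n S₁ S₂ =
    ncp x y z w x<z z<y y<w w≤n
      (subst Solid (sym (p≈p′ x y (<-trans x<z z<y) (<⇒≤ (<-≤-trans y<w w≤n)))) S₁)
      (subst Solid (sym (p≈p′ z w (<-trans z<y y<w) w≤n)) S₂)
  transport : EdgesAndBaseSolid n p → EdgesAndBaseSolid n p′
  transport (base , edges) =
    subst Solid (p≈p′ 0 n 1≤n ≤-refl) base , λ j j<n → subst Solid (p≈p′ j (suc j) ≤-refl j<n) (edges j j<n)

edgesAndBaseSolid : ∀ {n p} → 2 ≤ n → InSub n p → EdgesAndBaseSolid n p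
edgesAndBaseSolid _        (_ , inj₂ eb) = eb
edgesAndBaseSolid (s≤s ()) (_ , inj₁ refl)

inSub-glue : ∀ {n m1 s p q} → 2 ≤ n → 1 ≤ m1 → s < n → InSub n p → InSub (suc m1) q →
  InSub (Glue.N n m1 s) (Glue.Values.G n m1 s 𝟙 _⋆_ p q)
inSub-glue {n} {m1} {s} {p} {q} 2≤n 1≤m1 s<n Ip@((_ , _ , ncp) , _) Iq@((_ , _ , ncq) , _) =
  (<-trans z<s 1+m1<N′ , N≡1⇒unit , G-noncrossing Solid (λ 𝟙≢𝟙 → 𝟙≢𝟙 refl) s<n ncp ncq) ,
  inj₂ (subst Solid (sym (G-base 2≤n s<n)) (proj₁ p-solid) , edge-solid)
  where
  open Glue n m1 s
  open Values 𝟙 _⋆_ p q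
  1+m1<N′ : suc m1 < N
  1+m1<N′ = 1+m1<N 2≤n
  p-solid : EdgesAndBaseSolid n p
  p-solid = edgesAndBaseSolid 2≤n Ip
  q-solid : EdgesAndBaseSolid (suc m1) q
  q-solid = edgesAndBaseSolid (s≤s 1≤m1) Iq
  N≡1⇒unit : N ≡ 1 → G 0 1 ≡ 𝟙
  N≡1⇒unit N≡1 = contradiction N≡1 (>⇒≢ (<-trans (s≤s 1≤m1) 1+m1<N′))
  edge-solid : ∀ j → j < N → Solid (G j (suc j))
  edge-solid j j<N with G-edge 1≤m1 s<n j j<N
  ... | inj₁ (k , k<m , e) = subst Solid (sym e) (proj₂ q-solid k k<m)
  ... | inj₂ (k , k<n , e) = subst Solid (sym e) (proj₂ p-solid k k<n)

inSub-∘ : ∀ n m i p q → InSub n p → InSub m q → 1 ≤ i → i ≤ n →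
  InSub (n + m ∸ 1) (compNC n m p i q)
inSub-∘ zero _ _ _ _ ((() , _) , _) _ _ _
inSub-∘ (suc _) zero _ _ _ _ ((() , _) , _) _ _
inSub-∘ (suc _) (suc _) zero _ _ _ _ () _
inSub-∘ 1 (suc m1) 1 p q ((_ , p01≡𝟙 , _) , _) Iq _ _ =
  InSub-resp-Agree (glue-identityˡ 𝟙 _⋆_ p q m1 (cong (_⋆ q 0 (suc m1)) (p01≡𝟙 refl))) Iq
inSub-∘ 1 (suc _) (suc (suc _)) _ _ _ _ _ (s≤s ())
inSub-∘ n@(suc (suc _)) 1 (suc s) p q Ip ((_ , q01≡𝟙 , _) , _) _ _ =
  subst (λ k → InSub k (compNC n 1 p (suc s) q)) (sym (m+n∸n≡m n 1))
    (InSub-resp-Agree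
      (glue-identityʳ 𝟙 _⋆_ p q n s (trans (cong (p s (suc s) ⋆_) (q01≡𝟙 refl)) (⋆-identityʳ _))) Ip)
inSub-∘ (suc (suc _)) (suc (suc _)) (suc _) _ _ Ip Iq _ s<n = inSub-glue (s≤s (s≤s z≤n)) (s≤s z≤n) s<n Ip Iq

arcLabel : Bool → Col → M
arcLabel _     thick  = a
arcLabel _     dotted = b
arcLabel true  none   = b
arcLabel false none   = 𝟙

arcColour : Bool → M → Col
arcColour _     a = thick
arcColour true  b = none
arcColour false b = dotted
arcColour _     𝟙 = none

arcColour-arcLabel : ∀ e u → (e ≡ true → u ≢ dotted) → arcColour e (arcLabel e u) ≡ u
arcColour-arcLabel _     thick  _ = refl
arcColour-arcLabel true  dotted h = contradiction refl (h refl)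
arcColour-arcLabel false dotted _ = refl
arcColour-arcLabel true  none   _ = refl
arcColour-arcLabel false none   _ = refl

arcLabel-arcColour : ∀ e v → (e ≡ true → Solid v) → arcLabel e (arcColour e v) ≡ v
arcLabel-arcColour _     a _ = refl
arcLabel-arcColour true  b _ = refl
arcLabel-arcColour false b _ = refl
arcLabel-arcColour true  𝟙 h = contradiction refl (h refl)
arcLabel-arcColour false 𝟙 _ = refl

arcLabel-true-solid : ∀ u → Solid (arcLabel true u)
arcLabel-true-solid thick  ()
arcLabel-true-solid dotted ()
arcLabel-true-solid none   ()

arcLabel-false-solid⇒present : ∀ u → Solid (arcLabel false u) → Present u
arcLabel-false-solid⇒present none   S refl = S refl
arcLabel-false-solid⇒present thick  _ ()
arcLabel-false-solid⇒present dotted _ ()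

arcColour-present⇒solid : ∀ e v → Present (arcColour e v) → Solid v
arcColour-present⇒solid _ 𝟙 P refl = P refl
arcColour-present⇒solid _ a _ ()
arcColour-present⇒solid _ b _ ()

arcColour-dotted : ∀ e v → arcColour e v ≡ dotted → e ≡ false
arcColour-dotted false b _ = refl
arcColour-dotted true  b ()
arcColour-dotted _     a ()
arcColour-dotted _     𝟙 ()

arcLabel-combine : ∀ u v → u ≢ dotted → v ≢ dotted →
  arcLabel false (combine u v) ≡ arcLabel true u ⋆ arcLabel true v
arcLabel-combine none   none   _ _ = refl
arcLabel-combine none   thick  _ _ = refl
arcLabel-combine thick  none   _ _ = refl
arcLabel-combine thick  thick  _ _ = refl
arcLabel-combine dotted _      u≢dotted _ = contradiction refl u≢dotted
arcLabel-combine none   dotted _ v≢dotted = contradiction refl v≢dotted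
arcLabel-combine thick  dotted _ v≢dotted = contradiction refl v≢dotted

φBNC-arcLabel : ∀ {n} c x y → 2 ≤ n → φBNC n c x y ≡ arcLabel (isEdgeOrBase n x y) (c x y)
φBNC-arcLabel {suc (suc k)} c x y _ with c x y
... | thick  = refl
... | dotted = refl
... | none with isEdgeOrBase (suc (suc k)) x y
...   | true  = refl
...   | false = refl
φBNC-arcLabel {suc zero} _ _ _ (s≤s ())

φBNC-edgeOrBase : ∀ {n} c x y → 2 ≤ n → IsEdgeOrBase n x y → φBNC n c x y ≡ arcLabel true (c x y)
φBNC-edgeOrBase c x y 2≤n eb =
  trans (φBNC-arcLabel c x y 2≤n) (cong (λ e → arcLabel e (c x y)) (isEdgeOrBase-true eb))

φBNC-¬edgeOrBase : ∀ {n} c x y → 2 ≤ n → ¬ IsEdgeOrBase n x y → φBNC n c x y ≡ arcLabel false (c x y)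
φBNC-¬edgeOrBase c x y 2≤n ¬eb =
  trans (φBNC-arcLabel c x y 2≤n) (cong (λ e → arcLabel e (c x y)) (isEdgeOrBase-false ¬eb))

edgeOrBase-¬dotted : ∀ {n c x y} → IsBNC n c → x < y → y ≤ n → IsEdgeOrBase n x y → c x y ≢ dotted
edgeOrBase-¬dotted {x = x} {y} (_ , _ , _ , dotted⇒diagonal) x<y y≤n eb =
  edgeOrBase⇒¬diagonal eb ∘ dotted⇒diagonal x y x<y y≤n

isBNC-unit : IsBNC 1 unitBNC
isBNC-unit = ≤-refl , (λ _ → refl) , (λ _ _ _ _ _ _ _ _ P _ → P refl) , λ _ _ _ _ ()

φBNC-inSub : ∀ n c → IsBNC n c → InSub n (φBNC n c)
φBNC-inSub zero _ (() , _)
φBNC-inSub 1 _ _ = inSub-unit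
φBNC-inSub n@(suc (suc _)) c (_ , _ , ncc , _) = (s≤s z≤n , (λ ()) , nc) , inj₂ (base , edges)
  where
  2≤n : 2 ≤ n
  2≤n = s≤s (s≤s z≤n)
  nc : NonCrossing Solid n (φBNC n c)
  nc x y z w x<z z<y y<w w≤n S₁ S₂ =
    ncc x y z w x<z z<y y<w w≤n
      (arcLabel-false-solid⇒present (c x y)
        (subst Solid (φBNC-¬edgeOrBase c x y 2≤n (crossing⇒¬edgeOrBaseˡ (x<z , z<y , y<w) w≤n)) S₁))
      (arcLabel-false-solid⇒present (c z w)
        (subst Solid (φBNC-¬edgeOrBase c z w 2≤n (crossing⇒¬edgeOrBaseʳ (x<z , z<y , y<w) w≤n)) S₂))
  base : Solid (φBNC n c 0 n)
  base = subst Solid (sym (φBNC-edgeOrBase c 0 n 2≤n (inj₂ (refl , refl)))) (arcLabel-true-solid (c 0 n))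
  edges : ∀ j → j < n → Solid (φBNC n c j (suc j))
  edges j _ =
    subst Solid (sym (φBNC-edgeOrBase c j (suc j) 2≤n (inj₁ refl))) (arcLabel-true-solid (c j (suc j)))

φBNC-injective : ∀ n c c′ → IsBNC n c → IsBNC n c′ → Agree n (φBNC n c) (φBNC n c′) → Agree n c c′
φBNC-injective zero _ _ (() , _) _ _
φBNC-injective 1 _ _ (_ , c01≡none , _) (_ , c′01≡none , _) _ .0 .1 (s≤s z≤n) (s≤s z≤n) =
  trans (c01≡none refl) (sym (c′01≡none refl))
φBNC-injective n@(suc (suc _)) c c′ Ic Ic′ φc≈φc′ x y x<y y≤n = begin
  c x y                              ≡⟨ sym (arcColour-arcLabel e (c x y) (¬dotted Ic)) ⟩
  arcColour e (arcLabel e (c x y))   ≡⟨ cong (arcColour e) sameLabel ⟩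
  arcColour e (arcLabel e (c′ x y))  ≡⟨ arcColour-arcLabel e (c′ x y) (¬dotted Ic′) ⟩
  c′ x y                             ∎
  where
  open ≡-Reasoning
  2≤n : 2 ≤ n
  2≤n = s≤s (s≤s z≤n)
  e : Bool
  e = isEdgeOrBase n x y
  ¬dotted : ∀ {c} → IsBNC n c → e ≡ true → c x y ≢ dotted
  ¬dotted Ic e≡true = edgeOrBase-¬dotted Ic x<y y≤n (isEdgeOrBase-true⁻¹ e≡true)
  sameLabel : arcLabel e (c x y) ≡ arcLabel e (c′ x y)
  sameLabel = trans (sym (φBNC-arcLabel c x y 2≤n)) (trans (φc≈φc′ x y x<y y≤n) (φBNC-arcLabel c′ x y 2≤n))

φBNC-surjective : ∀ n p → InSub n p → Σ (Deco Col) (λ c → IsBNC n c × Agree n (φBNC n c) p)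
φBNC-surjective zero _ ((() , _) , _)
φBNC-surjective 1 _ ((_ , p01≡𝟙 , _) , _) =
  unitBNC , isBNC-unit , λ { .0 .1 (s≤s z≤n) (s≤s z≤n) → sym (p01≡𝟙 refl) }
φBNC-surjective n@(suc (suc _)) p Ip@((_ , _ , ncp) , _) =
  c , (s≤s z≤n , (λ ()) , nc , dotted⇒diagonal) , φc≈p
  where
  2≤n : 2 ≤ n
  2≤n = s≤s (s≤s z≤n)
  c : Deco Col
  c x y = arcColour (isEdgeOrBase n x y) (p x y)
  nc : NonCrossing Present n c
  nc x y z w x<z z<y y<w w≤n P₁ P₂ =
    ncp x y z w x<z z<y y<w w≤n
      (arcColour-present⇒solid _ (p x y) P₁) (arcColour-present⇒solid _ (p z w) P₂)
  dotted⇒diagonal : ∀ x y → x < y → y ≤ n → c x y ≡ dotted → IsDiagonal n x y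
  dotted⇒diagonal x y x<y _ dot =
    ¬edgeOrBase⇒diagonal x<y (isEdgeOrBase-false⁻¹ (arcColour-dotted _ (p x y) dot))
  edgeOrBase-solid : ∀ {x y} → y ≤ n → IsEdgeOrBase n x y → Solid (p x y)
  edgeOrBase-solid {x} y≤n (inj₁ refl)         = proj₂ (edgesAndBaseSolid 2≤n Ip) x y≤n
  edgeOrBase-solid _       (inj₂ (refl , refl)) = proj₁ (edgesAndBaseSolid 2≤n Ip)
  φc≈p : Agree n (φBNC n c) p
  φc≈p x y _ y≤n =
    trans (φBNC-arcLabel c x y 2≤n)
          (arcLabel-arcColour _ (p x y) (edgeOrBase-solid y≤n ∘ isEdgeOrBase-true⁻¹))

φBNC-glue : ∀ {n m1 s c d} → 2 ≤ n → 1 ≤ m1 → s < n → IsBNC n c → IsBNC (suc m1) d →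
  Agree (Glue.N n m1 s) (φBNC (Glue.N n m1 s) (Glue.Values.G n m1 s none combine c d))
                        (Glue.Values.G n m1 s 𝟙 _⋆_ (φBNC n c) (φBNC (suc m1) d))
φBNC-glue {n} {m1} {s} {c} {d} 2≤n 1≤m1 s<n Ic Id x y x<y y≤N =
  trans (φBNC-arcLabel Coloured.G x y 2≤N) (go (position x<y))
  where
  open Glue n m1 s
  module Coloured = Values none combine c d
  module Labelled = Values 𝟙 _⋆_ (φBNC n c) (φBNC (suc m1) d)
  open ≡-Reasoning
  2≤m : 2 ≤ suc m1
  2≤m = s≤s 1≤m1
  2≤N : 2 ≤ N
  2≤N = <-trans 2≤m (1+m1<N 2≤n)
  inheritedArc : ∀ {k} (h : Deco Col) {u v} → 2 ≤ k → isEdgeOrBase N x y ≡ isEdgeOrBase k u v →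
    Coloured.G x y ≡ h u v → Labelled.G x y ≡ φBNC k h u v →
    arcLabel (isEdgeOrBase N x y) (Coloured.G x y) ≡ Labelled.G x y
  inheritedArc h {u} {v} 2≤k sameKind coloured labelled =
    trans (cong₂ arcLabel sameKind coloured) (trans (sym (φBNC-arcLabel h u v 2≤k)) (sym labelled))
  go : Position x y → arcLabel (isEdgeOrBase N x y) (Coloured.G x y) ≡ Labelled.G x y
  go (glued refl refl) = begin
    arcLabel (isEdgeOrBase N s t) (Coloured.G s t)
      ≡⟨ cong₂ arcLabel (isEdgeOrBase-false (glued-¬edgeOrBase 2≤n 1≤m1 s<n)) Coloured.G-glued ⟩
    arcLabel false (combine (c s (suc s)) (d 0 (suc m1)))
      ≡⟨ arcLabel-combine _ _ (edgeOrBase-¬dotted Ic ≤-refl s<n (inj₁ refl))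
                              (edgeOrBase-¬dotted Id z<s ≤-refl (inj₂ (refl , refl))) ⟩
    arcLabel true (c s (suc s)) ⋆ arcLabel true (d 0 (suc m1))
      ≡⟨ sym (cong₂ _⋆_ (φBNC-edgeOrBase c s (suc s) 2≤n (inj₁ refl))
                        (φBNC-edgeOrBase d 0 (suc m1) 2≤m (inj₂ (refl , refl)))) ⟩
    φBNC n c s (suc s) ⋆ φBNC (suc m1) d 0 (suc m1)
      ≡⟨ sym Labelled.G-glued ⟩
    Labelled.G s t ∎
  go (inner s≤x y≤t ng) =
    inheritedArc d 2≤m (inner-edgeOrBase 2≤n 1≤m1 s<n x<y s≤x y≤t ng)
      (Coloured.G-inner s≤x y≤t ng) (Labelled.G-inner s≤x y≤t ng)
  go (outer ox oy ng) =
    inheritedArc c 2≤n (outer-edgeOrBase 2≤n 1≤m1 s<n x<y ox oy ng)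
      (Coloured.G-outer x<y ox oy ng) (Labelled.G-outer x<y ox oy ng)
  go (crossing cr) =
    trans (cong₂ arcLabel (isEdgeOrBase-false (crossing⇒¬edgeOrBase 2≤n 1≤m1 s<n y≤N cr))
                          (Coloured.G-crossing cr))
          (sym (Labelled.G-crossing cr))

φBNC-∘ : ∀ n m i c d → IsBNC n c → IsBNC m d → 1 ≤ i → i ≤ n →
  Agree (n + m ∸ 1) (φBNC (n + m ∸ 1) (compBNC n m c i d)) (compNC n m (φBNC n c) i (φBNC m d))
φBNC-∘ zero _ _ _ _ (() , _) _ _ _
φBNC-∘ (suc _) zero _ _ _ _ (() , _) _ _
φBNC-∘ (suc _) (suc _) zero _ _ _ _ () _
φBNC-∘ 1 (suc m1) 1 c d _ _ _ _ = glue-identityˡ 𝟙 _⋆_ (φBNC 1 c) (φBNC (suc m1) d) m1 refl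
φBNC-∘ 1 (suc _) (suc (suc _)) _ _ _ _ _ (s≤s ())
φBNC-∘ n@(suc (suc _)) 1 (suc s) c d _ _ _ _ =
  subst (λ k → Agree k (φBNC k c) (compNC n 1 (φBNC n c) (suc s) (φBNC 1 d))) (sym (m+n∸n≡m n 1))
    (glue-identityʳ 𝟙 _⋆_ (φBNC n c) (φBNC 1 d) n s (⋆-identityʳ _))
φBNC-∘ (suc (suc _)) (suc (suc _)) (suc _) _ _ Ic Id _ s<n = φBNC-glue (s≤s (s≤s z≤n)) (s≤s z≤n) s<n Ic Id

proposition5p3 :
    -- (1) the candidate family is a suboperad of NC M_BNC
    (InSub 1 unitNC ×
     (∀ n m i p q → InSub n p → InSub m q → 1 ≤ i → i ≤ n →
        InSub (n + m ∸ 1) (compNC n m p i q)))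
    ×
    -- (2) φ_BNC maps BNC(n) into it, bijectively
    (∀ n c → IsBNC n c → InSub n (φBNC n c))
    ×
    (∀ n c c′ → IsBNC n c → IsBNC n c′ →
        Agree n (φBNC n c) (φBNC n c′) → Agree n c c′)
    ×
    (∀ n p → InSub n p → Σ (Deco Col) (λ c → IsBNC n c × Agree n (φBNC n c) p))
    ×
    -- (3) φ_BNC is a morphism of operads (unit and partial compositions)
    Agree 1 (φBNC 1 unitBNC) unitNC
    ×
    (∀ n m i c d → IsBNC n c → IsBNC m d → 1 ≤ i → i ≤ n →
        Agree (n + m ∸ 1) (φBNC (n + m ∸ 1) (compBNC n m c i d))
                          (compNC n m (φBNC n c) i (φBNC m d)))
proposition5p3 =
  (inSub-unit , inSub-∘) , φBNC-inSub , φBNC-injective , φBNC-surjective , (λ _ _ _ _ → refl) , φBNC-∘
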